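{- Let $\lambda$ be a connectivity function on a finite set $E$ and let $P=(r,E)$ be the polymatroid induced by $\lambda$, i.e. $r(X)=\lambda(X)+\|X\|_\lambda$ for all $X\subseteq E$. Then (i) $\lambda_P(X)=2\lambda(X)$ for all $X\subseteq E$; (ii) $P$ is compact; (iii) $P$ is self-dual.
   Context: A connectivity function on $E$ is a function $\lambda:2^E\to\mathbb{R}$ with $\lambda(\emptyset)=0$, $\lambda(X)=\lambda(E-X)$ for all $X\subseteq E$, and $\lambda(X\cap Y)+\lambda(X\cup Y)\le\lambda(X)+\lambda(Y)$ for all $X,Y\subseteq E$. For $X\subseteq E$, $\|X\|_\lambda=\sum_{x\in X}\lambda(\{x\})$. For a polymatroid $P=(r,E)$ (with $r$ normalised, submodular, increasing), its connectivity function is $\lambda_P(X)=r(X)+r(E-X)-r(E)$; with $\|X\|_r=\sum_{x\in X}r(\{x\})$, its dual is $P^*=(r^*,E)$ where $r^*(X)=r(E-X)+\|X\|_r-r(E)$, and $P$ is self-dual if $r^*=r$. An element $e$ is compact if $r(\{e\})=\lambda_P(\{e\})$, and $P$ is compact if every element is compact. -}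

module Defs where

open import Level using (Level; _⊔_; suc)
open import Algebra.Bundles using (CommutativeRing)
open import Data.Bool using (true; false)
open import Data.Nat using (ℕ; zero) renaming (suc to sucℕ)
open import Data.Fin using (Fin) renaming (zero to fzero; suc to fsuc)
open import Data.Vec using ([]; _∷_)
open import Data.Fin.Subset using (Subset; ∁; _∩_; _∪_; ⁅_⁆; ⊥; ⊤)
open import Function using (_∘_)

-- Values live in an arbitrary commutative ring R (this includes ℝ).
-- Subsets of the finite ground set E = Fin n are Subset n.
module _ {c ℓ : Level} (R : CommutativeRing c ℓ) where
  open CommutativeRing R

  sumOver : ∀ {n} → (Fin n → Carrier) → Subset n → Carrier
  sumOver {zero}   f []          = 0#
  sumOver {sucℕ n} f (true ∷ X)  = f fzero + sumOver (f ∘ fsuc) X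
  sumOver {sucℕ n} f (false ∷ X) = sumOver (f ∘ fsuc) X

  norm : ∀ {n} → (Subset n → Carrier) → Subset n → Carrier
  norm f X = sumOver (λ x → f ⁅ x ⁆) X

  record IsConnectivityFunction {ℓ' : Level} (_≤_ : Carrier → Carrier → Set ℓ')
         {n : ℕ} (conn : Subset n → Carrier) : Set (c ⊔ ℓ ⊔ ℓ') where
    field
      empty  : conn ⊥ ≈ 0#
      symm   : ∀ X → conn X ≈ conn (∁ X)
      submod : ∀ X Y → (conn (X ∩ Y) + conn (X ∪ Y)) ≤ (conn X + conn Y)

  induced : ∀ {n} → (Subset n → Carrier) → Subset n → Carrier
  induced conn X = conn X + norm conn X

  connP : ∀ {n} → (Subset n → Carrier) → Subset n → Carrier
  connP r X = (r X + r (∁ X)) - r ⊤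

  dual : ∀ {n} → (Subset n → Carrier) → Subset n → Carrier
  dual r X = (r (∁ X) + norm r X) - r ⊤

  IsCompactElement : ∀ {n} → (Subset n → Carrier) → Fin n → Set ℓ
  IsCompactElement r e = r ⁅ e ⁆ ≈ connP r ⁅ e ⁆

  IsCompact : ∀ {n} → (Subset n → Carrier) → Set ℓ
  IsCompact r = ∀ e → IsCompactElement r e

  IsSelfDual : ∀ {n} → (Subset n → Carrier) → Set ℓ
  IsSelfDual r = ∀ X → dual r X ≈ r X

-- The norm ‖·‖_λ is modular (‖X‖ + ‖E − X‖ = ‖E‖), so adding it to λ does not change
-- the connectivity function: λ_P(X) = λ(X) + λ(E − X) − λ(E) = 2λ(X). On a singleton
-- both r and λ_P equal 2λ({e}), which is compactness, and ‖X‖_r = 2‖X‖_λ; feeding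
-- these into r*(X) = λ_P(X) + ‖X‖_r − r(X) gives r*(X) = r(X).
module Submission where

open import Defs
open import Level using (Level)
open import Algebra.Bundles using (CommutativeRing)
open import Algebra.Solver.Ring.AlmostCommutativeRing
  using (fromCommutativeRing; -raw-almostCommutative⟶)
import Algebra.Solver.Ring as RingSolver
import Algebra.Properties.AbelianGroup as AbelianGroupProperties
open import Data.Bool using (true; false)
open import Data.Fin using (Fin) renaming (zero to fzero; suc to fsuc)
open import Data.Fin.Subset using (Subset; ∁; ⁅_⁆; ⊥; ⊤)
open import Data.Maybe using (nothing)
open import Data.Nat using (ℕ; zero) renaming (suc to sucℕ)
open import Data.Product using (_×_; _,_)
open import Data.Vec using ([]; _∷_)
open import Function using (_∘_)
open import Relation.Binary.PropositionalEquality as ≡ using (_≡_)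
import Relation.Binary.Reasoning.Setoid as SetoidReasoning

∁⊤≡⊥ : ∀ n → ∁ (⊤ {n}) ≡ ⊥
∁⊤≡⊥ zero     = ≡.refl
∁⊤≡⊥ (sucℕ n) = ≡.cong (false ∷_) (∁⊤≡⊥ n)

module _ {c ℓ : Level} (R : CommutativeRing c ℓ) where
  open CommutativeRing R
  open SetoidReasoning setoid
  open RingSolver rawRing (fromCommutativeRing R) (-raw-almostCommutative⟶ _) (λ _ _ → nothing)
    using (solve; _:+_; _:-_; _:=_)
  open AbelianGroupProperties +-abelianGroup using (∙-cancelʳ; x≈y⇒x∙y⁻¹≈ε; ε⁻¹≈ε)

  sumOver-⊥ : ∀ {n} (f : Fin n → Carrier) → sumOver R f ⊥ ≈ 0#
  sumOver-⊥ {zero}   f = refl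
  sumOver-⊥ {sucℕ n} f = sumOver-⊥ (f ∘ fsuc)

  sumOver-⁅⁆ : ∀ {n} (f : Fin n → Carrier) e → sumOver R f ⁅ e ⁆ ≈ f e
  sumOver-⁅⁆ f fzero    = trans (+-congˡ (sumOver-⊥ (f ∘ fsuc))) (+-identityʳ _)
  sumOver-⁅⁆ f (fsuc e) = sumOver-⁅⁆ (f ∘ fsuc) e

  sumOver-cong : ∀ {n} {f g : Fin n → Carrier} → (∀ x → f x ≈ g x) → ∀ X →
                 sumOver R f X ≈ sumOver R g X
  sumOver-cong {zero}   f≈g []          = refl
  sumOver-cong {sucℕ n} f≈g (true ∷ X)  = +-cong (f≈g fzero) (sumOver-cong (f≈g ∘ fsuc) X)
  sumOver-cong {sucℕ n} f≈g (false ∷ X) = sumOver-cong (f≈g ∘ fsuc) X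

  sumOver-+ : ∀ {n} (f g : Fin n → Carrier) X →
              sumOver R (λ x → f x + g x) X ≈ sumOver R f X + sumOver R g X
  sumOver-+ {zero}   f g []          = sym (+-identityʳ 0#)
  sumOver-+ {sucℕ n} f g (false ∷ X) = sumOver-+ (f ∘ fsuc) (g ∘ fsuc) X
  sumOver-+ {sucℕ n} f g (true ∷ X)  = begin
    (f fzero + g fzero) + sumOver R (λ x → f (fsuc x) + g (fsuc x)) X
      ≈⟨ +-congˡ (sumOver-+ (f ∘ fsuc) (g ∘ fsuc) X) ⟩
    (f fzero + g fzero) + (F + G)
      ≈⟨ solve 4 (λ a b u v → (a :+ b) :+ (u :+ v) := (a :+ u) :+ (b :+ v))
               refl (f fzero) (g fzero) F G ⟩
    (f fzero + F) + (g fzero + G) ∎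
    where F = sumOver R (f ∘ fsuc) X
          G = sumOver R (g ∘ fsuc) X

  sumOver-⊤ : ∀ {n} (f : Fin n → Carrier) X →
              sumOver R f ⊤ ≈ sumOver R f X + sumOver R f (∁ X)
  sumOver-⊤ {zero}   f []          = sym (+-identityʳ 0#)
  sumOver-⊤ {sucℕ n} f (true ∷ X)  =
    trans (+-congˡ (sumOver-⊤ (f ∘ fsuc) X)) (sym (+-assoc _ _ _))
  sumOver-⊤ {sucℕ n} f (false ∷ X) = begin
    f fzero + sumOver R (f ∘ fsuc) ⊤  ≈⟨ +-congˡ (sumOver-⊤ (f ∘ fsuc) X) ⟩
    f fzero + (A + B)                 ≈⟨ solve 3 (λ x a b → x :+ (a :+ b) := a :+ (x :+ b))
                                                refl (f fzero) A B ⟩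
    A + (f fzero + B)                 ∎
    where A = sumOver R (f ∘ fsuc) X
          B = sumOver R (f ∘ fsuc) (∁ X)

  norm-⁅⁆ : ∀ {n} (f : Subset n → Carrier) e → norm R f ⁅ e ⁆ ≈ f ⁅ e ⁆
  norm-⁅⁆ f = sumOver-⁅⁆ (λ x → f ⁅ x ⁆)

  connP-norm : ∀ {n} (f : Subset n → Carrier) X → connP R (norm R f) X ≈ 0#
  connP-norm f X = x≈y⇒x∙y⁻¹≈ε (sym (sumOver-⊤ _ X))

  connP-+ : ∀ {n} (f g : Subset n → Carrier) X →
            connP R (λ Y → f Y + g Y) X ≈ connP R f X + connP R g X
  connP-+ f g X = solve 6
    (λ a b c d e h → ((a :+ b) :+ (c :+ d)) :- (e :+ h) := ((a :+ c) :- e) :+ ((b :+ d) :- h))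
    refl (f X) (g X) (f (∁ X)) (g (∁ X)) (f ⊤) (g ⊤)

  connP-induced : ∀ {n} (f : Subset n → Carrier) X → connP R (induced R f) X ≈ connP R f X
  connP-induced f X = begin
    connP R (induced R f) X              ≈⟨ connP-+ f (norm R f) X ⟩
    connP R f X + connP R (norm R f) X   ≈⟨ +-congˡ (connP-norm f X) ⟩
    connP R f X + 0#                     ≈⟨ +-identityʳ _ ⟩
    connP R f X                          ∎

  norm-induced : ∀ {n} (f : Subset n → Carrier) X →
                 norm R (induced R f) X ≈ norm R f X + norm R f X
  norm-induced f X = begin
    norm R (induced R f) X                             ≈⟨ sumOver-cong (λ x → +-congˡ (norm-⁅⁆ f x)) X ⟩
    sumOver R (λ x → f ⁅ x ⁆ + f ⁅ x ⁆) X              ≈⟨ sumOver-+ _ _ X ⟩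
    norm R f X + norm R f X                            ∎

  -- Stated with r X moved to the left: the ring solver cannot cancel r X − r X,
  -- since with abstract coefficients 1 + (−1) is not syntactically 0.
  dual+rank≈connP+norm : ∀ {n} (r : Subset n → Carrier) X →
                         dual R r X + r X ≈ connP R r X + norm R r X
  dual+rank≈connP+norm r X = solve 4
    (λ a b c d → ((b :+ d) :- c) :+ a := ((a :+ b) :- c) :+ d)
    refl (r X) (r (∁ X)) (r ⊤) (norm R r X)

  module _ {ℓ' : Level} {_≤_ : Carrier → Carrier → Set ℓ'} {n : ℕ} {conn : Subset n → Carrier}
           (isConn : IsConnectivityFunction R _≤_ conn) where
    open IsConnectivityFunction isConn

    conn-⊤ : conn ⊤ ≈ 0#
    conn-⊤ = trans (symm ⊤) (trans (reflexive (≡.cong conn (∁⊤≡⊥ n))) empty)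

    connP-conn : ∀ X → connP R conn X ≈ conn X + conn X
    connP-conn X = begin
      (conn X + conn (∁ X)) - conn ⊤   ≈⟨ +-cong (+-congˡ (sym (symm X))) (-‿cong conn-⊤) ⟩
      (conn X + conn X) - 0#           ≈⟨ +-congˡ ε⁻¹≈ε ⟩
      (conn X + conn X) + 0#           ≈⟨ +-identityʳ _ ⟩
      conn X + conn X                  ∎

    connP-induced-conn : ∀ X → connP R (induced R conn) X ≈ conn X + conn X
    connP-induced-conn X = trans (connP-induced conn X) (connP-conn X)

    induced-isCompact : IsCompact R (induced R conn)
    induced-isCompact e = begin
      conn ⁅ e ⁆ + norm R conn ⁅ e ⁆   ≈⟨ +-congˡ (norm-⁅⁆ conn e) ⟩
      conn ⁅ e ⁆ + conn ⁅ e ⁆          ≈⟨ connP-induced-conn ⁅ e ⁆ ⟨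
      connP R (induced R conn) ⁅ e ⁆   ∎

    induced-isSelfDual : IsSelfDual R (induced R conn)
    induced-isSelfDual X = ∙-cancelʳ (r X) _ _ (begin
      dual R r X + r X                                    ≈⟨ dual+rank≈connP+norm r X ⟩
      connP R r X + norm R r X                            ≈⟨ +-cong (connP-induced-conn X) (norm-induced conn X) ⟩
      (conn X + conn X) + (norm R conn X + norm R conn X) ≈⟨ solve 2 (λ a b → (a :+ a) :+ (b :+ b) := (a :+ b) :+ (a :+ b))
                                                                   refl (conn X) (norm R conn X) ⟩
      r X + r X                                           ∎)
      where r = induced R conn

lemma4p3 : ∀ {c ℓ ℓ' : Level} (R : CommutativeRing c ℓ)
             (_≤_ : CommutativeRing.Carrier R → CommutativeRing.Carrier R → Set ℓ')
             (n : ℕ) (conn : Subset n → CommutativeRing.Carrier R) →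
             IsConnectivityFunction R _≤_ conn →
             ((∀ X → CommutativeRing._≈_ R (connP R (induced R conn) X) (CommutativeRing._+_ R (conn X) (conn X)))
              × IsCompact R (induced R conn)
              × IsSelfDual R (induced R conn))
lemma4p3 R _≤_ n conn isConn =
  connP-induced-conn R isConn , induced-isCompact R isConn , induced-isSelfDual R isConn
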